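{- Let $G$ be a connected graph of order $n$ and let $S$ be a distinguishing set of $G$ with $|S|=k$. Then: (1) $|V(G^S)|=n-k$; (2) $G^S$ is bipartite; (3) incident (distinct) edges of $G^S$ have different labels; (4) every cycle of $G^S$ contains an even number of edges labeled $v$, for every $v\in S$; (5) if $\rho$ is a walk in $G^S$ with no repeated edges that contains an even number of edges labeled $v$ for every $v\in S$, then $\rho$ is a closed walk; (6) if $\rho=x_ix_{i+1}\dots x_{i+h}$ is a path in $G^S$ such that, for every $m\in\{0,1,\dots,h\}$, the vertex $x_{i+m}$ lies at level $i+m$, then (a) the edges of $\rho$ have pairwise different labels, and (b) for every $j\in\{i+1,\dots,i+h\}$ and every $t\in\{i,i+1,\dots,j-1\}$, the set $N(x_j)\cap S$ contains the vertex $\ell(x_tx_{t+1})$.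
   Context: $N(x)$ is the open neighborhood of $x$ in $G$. A set $S\subseteq V$ is distinguishing if $N(x)\cap S\neq N(y)\cap S$ for all distinct $x,y\in V\setminus S$. The $S$-associated graph $G^S$ is the edge-labeled graph with vertex set $V\setminus S$, where $x,y$ are adjacent iff $N(x)\cap S$ and $N(y)\cap S$ differ in exactly one vertex $u\in S$ (symmetric difference $\{u\}$), and then the edge $xy$ has label $\ell(xy)=u$. The level of $z\in V\setminus S$ is $|N(z)\cap S|$. -}

module Defs where

open import Data.Nat using (ℕ; zero; suc; _+_; _≤_)
open import Data.Bool using (Bool; true; false)
open import Data.Fin using (Fin)
open import Data.Fin.Subset using (Subset; _∈_; _∉_; _∩_; ∣_∣)
open import Data.Vec using (Vec; tabulate; lookup)
open import Data.List using (List; []; _∷_; length; filter)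
open import Data.List.Relation.Unary.AllPairs using (AllPairs)
open import Data.Product using (_×_; _,_)
open import Data.Sum using (_⊎_)
open import Relation.Binary.PropositionalEquality using (_≡_; _≢_)
open import Relation.Nullary using (¬_)
open import Data.Fin using (_≟_)

record Graph (n : ℕ) : Set where
  field
    adj    : Fin n → Fin n → Bool
    sym    : ∀ x y → adj x y ≡ adj y x
    irrefl : ∀ x → adj x x ≡ false
open Graph public

N : ∀ {n} → Graph n → Fin n → Subset n
N G x = tabulate (adj G x)

data Reach {n} (G : Graph n) : Fin n → Fin n → Set where
  here : ∀ {x} → Reach G x x
  step : ∀ {x y z} → adj G x y ≡ true → Reach G y z → Reach G x z

Connected : ∀ {n} → Graph n → Set
Connected G = ∀ x y → Reach G x y

Distinguishing : ∀ {n} → Graph n → Subset n → Set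
Distinguishing G S = ∀ x y → x ∉ S → y ∉ S → x ≢ y → (N G x ∩ S) ≢ (N G y ∩ S)

SymDiffIsSingleton : ∀ {n} → Subset n → Subset n → Fin n → Set
SymDiffIsSingleton A B u = (lookup A u ≢ lookup B u) × (∀ w → w ≢ u → lookup A w ≡ lookup B w)

GSEdge : ∀ {n} → Graph n → Subset n → Fin n → Fin n → Fin n → Set
GSEdge G S x y u = x ∉ S × y ∉ S × SymDiffIsSingleton (N G x ∩ S) (N G y ∩ S) u

level : ∀ {n} → Graph n → Subset n → Fin n → ℕ
level G S z = ∣ N G z ∩ S ∣

data GSWalk {n} (G : Graph n) (S : Subset n) : Fin n → Fin n → Set where
  []  : ∀ {x} → x ∉ S → GSWalk G S x x
  _∷_ : ∀ {x y z} {u : Fin n} → GSEdge G S x y u → GSWalk G S y z → GSWalk G S x z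

module _ {n} {G : Graph n} {S : Subset n} where

  len : ∀ {x y} → GSWalk G S x y → ℕ
  len ([] _) = 0
  len (_∷_ e w) = suc (len w)

  labels : ∀ {x y} → GSWalk G S x y → List (Fin n)
  labels ([] _) = []
  labels (_∷_ {u = u} e w) = u ∷ labels w

  verts : ∀ {x y} → GSWalk G S x y → List (Fin n)
  verts {x} ([] _) = x ∷ []
  verts {x} (_∷_ e w) = x ∷ verts w

  initVerts : ∀ {x y} → GSWalk G S x y → List (Fin n)
  initVerts ([] _) = []
  initVerts {x} (_∷_ e w) = x ∷ initVerts w

  edges : ∀ {x y} → GSWalk G S x y → List (Fin n × Fin n)
  edges ([] _) = []
  edges {x} (_∷_ {y = y} e w) = (x , y) ∷ edges w

SameEdge : ∀ {n} → Fin n × Fin n → Fin n × Fin n → Set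
SameEdge (a , b) (c , d) = (a ≡ c × b ≡ d) ⊎ (a ≡ d × b ≡ c)

NoRepeatedEdges : ∀ {n} {G : Graph n} {S : Subset n} {x y} → GSWalk G S x y → Set
NoRepeatedEdges w = AllPairs (λ e f → ¬ SameEdge e f) (edges w)

IsCycle : ∀ {n} {G : Graph n} {S : Subset n} {x} → GSWalk G S x x → Set
IsCycle w = (3 ≤ len w) × AllPairs _≢_ (initVerts w)

IsPath : ∀ {n} {G : Graph n} {S : Subset n} {x y} → GSWalk G S x y → Set
IsPath w = AllPairs _≢_ (verts w)

countLabel : ∀ {n} {G : Graph n} {S : Subset n} {x y} → GSWalk G S x y → Fin n → ℕ
countLabel w v = length (filter (_≟ v) (labels w))

GSAdj : ∀ {n} → Graph n → Subset n → Fin n → Fin n → Set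
GSAdj {n} G S x y = Data.Product.∃ λ (u : Fin n) → GSEdge G S x y u
  where import Data.Product

-- Everything is read off the trace N(x) ∩ S of a vertex.  Along an edge labelled u the trace
-- changes exactly in u, so the level changes by one (G^S is bipartite by level parity), and along
-- a walk the membership of v in the trace flips once per v-labelled edge: closed walks use every
-- label an even number of times, and conversely a walk with even label counts returns to a vertex
-- with the same trace, which is its start because S is distinguishing.  On a path whose levels
-- rise by one at each step every edge adds its label to the trace, so traces only grow along it.
module Submission where

open import Defs hiding (sym)
open import Data.Nat using (ℕ; _+_; _∸_; _<_)
open import Data.Nat.Divisibility using (_∣_)
open import Data.Bool using (Bool)
open import Data.Fin using (Fin; toℕ)
open import Data.Fin.Subset using (Subset; _∈_; _∉_; _∩_; ∁; ∣_∣)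
open import Data.List using (length; lookup)
open import Data.List.Relation.Unary.AllPairs using (AllPairs)
open import Data.Product using (_×_; Σ)
open import Relation.Binary.PropositionalEquality using (_≡_; _≢_)

open import Data.Nat using (zero; suc; _*_; s≤s)
open import Data.Nat.Properties using (+-suc; +-identityʳ; m≢1+n+m)
open import Data.Nat.Divisibility using (divides)
open import Data.Bool using (true; false; not; _xor_)
open import Data.Bool.Properties using (not-involutive; not-¬; ¬-not; not-distribˡ-xor)
open import Data.Fin using (zero; suc; _≟_)
import Data.Fin.Properties as Fin
open import Data.Fin.Subset using (_⊆_)
open import Data.Fin.Subset.Properties using (∣∁p∣≡n∸∣p∣; _∈?_; x∈p∩q⁻; ⊆-trans)
open import Data.Vec using (Vec; _∷_; tabulate)
import Data.Vec as Vec
open import Data.Vec.Properties using (lookup⇒[]=; []=⇒lookup; tabulate∘lookup; tabulate-cong)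
open import Data.List.Relation.Unary.All as All using (All)
import Data.List.Relation.Unary.AllPairs as AllPairs
open import Data.Product using (_,_; proj₂)
open import Data.Sum using (_⊎_; inj₁; inj₂)
open import Data.Unit using (⊤; tt)
open import Data.Empty using (⊥-elim)
open import Function using (_∘_; id)
open import Relation.Nullary using (yes; no)
open import Relation.Binary.PropositionalEquality using (_≗_; refl; sym; trans; cong; subst)
open Relation.Binary.PropositionalEquality.≡-Reasoning

odd : ℕ → Bool
odd zero    = false
odd (suc m) = not (odd m)

odd≢odd-suc : ∀ m → odd m ≢ odd (suc m)
odd≢odd-suc m = not-¬ refl

2∣⇒odd≡false : ∀ m → 2 ∣ m → odd m ≡ false
2∣⇒odd≡false _ (divides q refl) = even q
  where
  even : ∀ q → odd (q * 2) ≡ false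
  even zero    = refl
  even (suc q) = trans (not-involutive _) (even q)

odd≡false⇒2∣ : ∀ m → odd m ≡ false → 2 ∣ m
odd≡false⇒2∣ zero          _    = divides 0 refl
odd≡false⇒2∣ (suc zero)    ()
odd≡false⇒2∣ (suc (suc m)) even with odd≡false⇒2∣ m (trans (sym (not-involutive (odd m))) even)
... | divides q m≡q*2 = divides (suc q) (cong (2 +_) m≡q*2)

xor-absorbs⇒false : ∀ p b → b ≡ p xor b → p ≡ false
xor-absorbs⇒false false _     _  = refl
xor-absorbs⇒false true  false ()
xor-absorbs⇒false true  true  ()

≗⇒≡ : ∀ {A : Set} {m} (xs ys : Vec A m) → Vec.lookup xs ≗ Vec.lookup ys → xs ≡ ys
≗⇒≡ xs ys xs≗ys = begin
  xs                       ≡⟨ sym (tabulate∘lookup xs) ⟩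
  tabulate (Vec.lookup xs) ≡⟨ tabulate-cong xs≗ys ⟩
  tabulate (Vec.lookup ys) ≡⟨ tabulate∘lookup ys ⟩
  ys                       ∎

∣p∣≡suc∣q∣-differing-at : ∀ {m} (p q : Subset m) u →
  Vec.lookup p u ≡ true → Vec.lookup q u ≡ false →
  (∀ w → w ≢ u → Vec.lookup p w ≡ Vec.lookup q w) → ∣ p ∣ ≡ suc ∣ q ∣
∣p∣≡suc∣q∣-differing-at (true ∷ p) (false ∷ q) zero refl refl agree =
  cong (suc ∘ ∣_∣) (≗⇒≡ p q λ w → agree (suc w) λ ())
∣p∣≡suc∣q∣-differing-at (a ∷ p) (b ∷ q) (suc u) pᵤ qᵤ agree with agree zero (λ ())
... | refl = cons a (∣p∣≡suc∣q∣-differing-at p q u pᵤ qᵤ λ w w≢u → agree (suc w) (w≢u ∘ Fin.suc-injective))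
  where
  cons : ∀ a → ∣ p ∣ ≡ suc ∣ q ∣ → ∣ a ∷ p ∣ ≡ suc ∣ a ∷ q ∣
  cons true  = cong suc
  cons false = id

module _ {n} (G : Graph n) (S : Subset n) where

  trace : Fin n → Subset n
  trace x = N G x ∩ S

  trace-outside : ∀ x {v} → v ∉ S → Vec.lookup (trace x) v ≡ false
  trace-outside x {v} v∉S = ¬-not λ v∈trace → v∉S (proj₂ (x∈p∩q⁻ (N G x) S (lookup⇒[]= v _ v∈trace)))

  trace-injective : Distinguishing G S → ∀ {x y} → x ∉ S → y ∉ S → trace x ≡ trace y → x ≡ y
  trace-injective distinguishing {x} {y} x∉S y∉S eq with x ≟ y
  ... | yes x≡y = x≡y
  ... | no  x≢y = ⊥-elim (distinguishing x y x∉S y∉S x≢y eq)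

  GSEdge-sym : ∀ {x y u} → GSEdge G S x y u → GSEdge G S y x u
  GSEdge-sym (x∉S , y∉S , differ , agree) = y∉S , x∉S , differ ∘ sym , λ w w≢u → sym (agree w w≢u)

  edge-label-flips : ∀ {x y u b} → GSEdge G S x y u → Vec.lookup (trace y) u ≡ b →
                     Vec.lookup (trace x) u ≡ not b
  edge-label-flips (_ , _ , differ , _) yᵤ = trans (¬-not differ) (cong not yᵤ)

  edge-level : ∀ {x y u} → GSEdge G S x y u → Vec.lookup (trace y) u ≡ true →
               level G S y ≡ suc (level G S x)
  edge-level {x} {y} {u} e@(_ , _ , _ , agree) yᵤ =
    ∣p∣≡suc∣q∣-differing-at (trace y) (trace x) u yᵤ (edge-label-flips e yᵤ) λ w w≢u → sym (agree w w≢u)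

  edge-orientation : ∀ {x y u} → GSEdge G S x y u →
    (u ∈ trace y × level G S y ≡ suc (level G S x)) ⊎ (u ∈ trace x × level G S x ≡ suc (level G S y))
  edge-orientation {x} {y} {u} e = by-side _ refl
    where
    by-side : ∀ b → Vec.lookup (trace y) u ≡ b →
      (u ∈ trace y × level G S y ≡ suc (level G S x)) ⊎ (u ∈ trace x × level G S x ≡ suc (level G S y))
    by-side true  yᵤ = inj₁ (lookup⇒[]= u (trace y) yᵤ , edge-level e yᵤ)
    by-side false yᵤ = inj₂ (lookup⇒[]= u (trace x) xᵤ , edge-level (GSEdge-sym e) xᵤ)
      where xᵤ = edge-label-flips e yᵤ

  edge-level-parity : ∀ {x y} → GSAdj G S x y → odd (level G S x) ≢ odd (level G S y)
  edge-level-parity {x} {y} (_ , e) with edge-orientation e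
  ... | inj₁ (_ , up)   rewrite up   = odd≢odd-suc (level G S x)
  ... | inj₂ (_ , down) rewrite down = odd≢odd-suc (level G S y) ∘ sym

  edges-with-same-label : Distinguishing G S → ∀ {x y z u} →
    GSEdge G S x y u → GSEdge G S x z u → y ≡ z
  edges-with-same-label distinguishing {y = y} {z} {u}
    (_ , y∉S , differ-y , agree-y) (_ , z∉S , differ-z , agree-z) =
    trace-injective distinguishing y∉S z∉S (≗⇒≡ _ _ same)
    where
    same : ∀ w → Vec.lookup (trace y) w ≡ Vec.lookup (trace z) w
    same w with w ≟ u
    ... | yes refl = trans (¬-not (differ-y ∘ sym)) (sym (¬-not (differ-z ∘ sym)))
    ... | no  w≢u  = trans (sym (agree-y w w≢u)) (agree-z w w≢u)

  source∉S : ∀ {x y} → GSWalk G S x y → x ∉ S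
  source∉S ([] x∉S)        = x∉S
  source∉S ((x∉S , _) ∷ _) = x∉S

  target∉S : ∀ {x y} → GSWalk G S x y → y ∉ S
  target∉S ([] y∉S) = y∉S
  target∉S (_ ∷ w)  = target∉S w

  trace-parity : ∀ {x y} (w : GSWalk G S x y) v →
    Vec.lookup (trace x) v ≡ odd (countLabel w v) xor Vec.lookup (trace y) v
  trace-parity ([] _) v = refl
  trace-parity {x} {z} (_∷_ {y = y} {u = u} (_ , _ , differ , agree) w) v with u ≟ v
  ... | yes refl = begin
    Vec.lookup (trace x) u                                ≡⟨ ¬-not differ ⟩
    not (Vec.lookup (trace y) u)                          ≡⟨ cong not (trace-parity w u) ⟩
    not (odd (countLabel w u) xor Vec.lookup (trace z) u) ≡⟨ not-distribˡ-xor (odd (countLabel w u)) _ ⟩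
    not (odd (countLabel w u)) xor Vec.lookup (trace z) u ∎
  ... | no  u≢v  = trans (agree v (u≢v ∘ sym)) (trace-parity w v)

  closed-walk-even : ∀ {x} (w : GSWalk G S x x) v → 2 ∣ countLabel w v
  closed-walk-even {x} w v =
    odd≡false⇒2∣ _ (xor-absorbs⇒false _ (Vec.lookup (trace x) v) (trace-parity w v))

  even-walk-closed : Distinguishing G S → ∀ {x y} (w : GSWalk G S x y) →
    (∀ v → v ∈ S → 2 ∣ countLabel w v) → x ≡ y
  even-walk-closed distinguishing {x} {y} w even =
    trace-injective distinguishing (source∉S w) (target∉S w) (≗⇒≡ _ _ same)
    where
    same : ∀ v → Vec.lookup (trace x) v ≡ Vec.lookup (trace y) v
    same v with v ∈? S
    ... | yes v∈S = trans (trace-parity w v) (cong (_xor _) (2∣⇒odd≡false _ (even v v∈S)))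
    ... | no  v∉S = trans (trace-outside x v∉S) (sym (trace-outside y v∉S))

  Ascending : ∀ {x y} → GSWalk G S x y → Set
  Ascending ([] _) = ⊤
  Ascending (_∷_ {x} {y} _ w) = level G S y ≡ suc (level G S x) × Ascending w

  levels-from⇒ascending : ∀ i {x y} (w : GSWalk G S x y) →
    (∀ m → level G S (lookup (verts w) m) ≡ i + toℕ m) → Ascending w
  levels-from⇒ascending i ([] _) _ = tt
  levels-from⇒ascending i (_ ∷ w) levels =
    trans (source-level w levels′) (cong suc (sym (trans (levels zero) (+-identityʳ i))))
    , levels-from⇒ascending (suc i) w levels′
    where
    levels′ : ∀ m → level G S (lookup (verts w) m) ≡ suc i + toℕ m
    levels′ m = trans (levels (suc m)) (+-suc i (toℕ m))
    source-level : ∀ {j y z} (w : GSWalk G S y z) →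
      (∀ m → level G S (lookup (verts w) m) ≡ j + toℕ m) → level G S y ≡ j
    source-level {j} ([] _) levels = trans (levels zero) (+-identityʳ j)
    source-level {j} (_ ∷ _) levels = trans (levels zero) (+-identityʳ j)

  ascending-edge-label∈ : ∀ {x y u} → GSEdge G S x y u → level G S y ≡ suc (level G S x) →
    u ∈ trace y
  ascending-edge-label∈ {x} e up with edge-orientation e
  ... | inj₁ (u∈y , _)  = u∈y
  ... | inj₂ (_ , down) = ⊥-elim (m≢1+n+m (level G S x) (trans down (cong suc up)))

  edge-label∉source : ∀ {x y u} → GSEdge G S x y u → u ∈ trace y → u ∉ trace x
  edge-label∉source (_ , _ , differ , _) u∈y u∈x = differ (trans ([]=⇒lookup u∈x) (sym ([]=⇒lookup u∈y)))

  edge-trace-⊆ : ∀ {x y u} → GSEdge G S x y u → u ∈ trace y → trace x ⊆ trace y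
  edge-trace-⊆ {x} {y} {u} (_ , _ , _ , agree) u∈y {w} w∈x with w ≟ u
  ... | yes refl = u∈y
  ... | no  w≢u  = lookup⇒[]= w (trace y) (trans (sym (agree w w≢u)) ([]=⇒lookup w∈x))

  ascending-trace-⊆ : ∀ {x y} (w : GSWalk G S x y) → Ascending w →
    ∀ j → trace x ⊆ trace (lookup (verts w) j)
  ascending-trace-⊆ ([] _) _ zero = id
  ascending-trace-⊆ (_ ∷ _) _ zero = id
  ascending-trace-⊆ (e ∷ w) (up , asc) (suc j) =
    ⊆-trans (edge-trace-⊆ e (ascending-edge-label∈ e up)) (ascending-trace-⊆ w asc j)

  ascending-labels∉source : ∀ {x y} (w : GSWalk G S x y) → Ascending w → All (_∉ trace x) (labels w)
  ascending-labels∉source ([] _) _ = All.[]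
  ascending-labels∉source (e ∷ w) (up , asc) =
    edge-label∉source e u∈y All.∷ All.map (_∘ edge-trace-⊆ e u∈y) (ascending-labels∉source w asc)
    where u∈y = ascending-edge-label∈ e up

  ascending-labels-distinct : ∀ {x y} (w : GSWalk G S x y) → Ascending w → AllPairs _≢_ (labels w)
  ascending-labels-distinct ([] _) _ = AllPairs.[]
  ascending-labels-distinct (_∷_ {y = y} e w) (up , asc) =
    All.map (λ l∉y u≡l → l∉y (subst (_∈ trace y) u≡l (ascending-edge-label∈ e up)))
      (ascending-labels∉source w asc)
    AllPairs.∷ ascending-labels-distinct w asc

  ascending-label∈later-trace : ∀ {x y} (w : GSWalk G S x y) → Ascending w →
    ∀ j t → toℕ t < toℕ j → lookup (labels w) t ∈ trace (lookup (verts w) j)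
  ascending-label∈later-trace (e ∷ w) (up , asc) (suc j) zero _ =
    ascending-trace-⊆ w asc j (ascending-edge-label∈ e up)
  ascending-label∈later-trace (e ∷ w) (_ , asc) (suc j) (suc t) (s≤s t<j) =
    ascending-label∈later-trace w asc j t t<j

proposition8 : ∀ {n k : ℕ} (G : Graph n) (S : Subset n) →
    Connected G → Distinguishing G S → ∣ S ∣ ≡ k →
    (∣ ∁ S ∣ ≡ n ∸ k)
    × (Σ (Fin n → Bool) λ c → ∀ x y → GSAdj G S x y → c x ≢ c y)
    × (∀ x y z u v → GSEdge G S x y u → GSEdge G S x z v → y ≢ z → u ≢ v)
    × (∀ x (w : GSWalk G S x x) → IsCycle w → ∀ v → v ∈ S → 2 ∣ countLabel w v)
    × (∀ x y (w : GSWalk G S x y) → NoRepeatedEdges w →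
         (∀ v → v ∈ S → 2 ∣ countLabel w v) → x ≡ y)
    × (∀ (i : ℕ) x y (w : GSWalk G S x y) → IsPath w →
         (∀ m → level G S (lookup (verts w) m) ≡ i + toℕ m) →
         AllPairs _≢_ (labels w)
         × (∀ j t → toℕ t < toℕ j →
              lookup (labels w) t ∈ (N G (lookup (verts w) j) ∩ S)))
proposition8 G S _ distinguishing refl =
    ∣∁p∣≡n∸∣p∣ S
  , (odd ∘ level G S , λ _ _ → edge-level-parity G S)
  , (λ { _ _ _ _ _ e f y≢z refl → y≢z (edges-with-same-label G S distinguishing e f) })
  , (λ _ w _ v _ → closed-walk-even G S w v)
  , (λ _ _ w _ → even-walk-closed G S distinguishing w)
  , λ i _ _ w _ levels → let asc = levels-from⇒ascending G S i w levels in
      ascending-labels-distinct G S w asc , ascending-label∈later-trace G S w asc
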